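{- Let $n \geq 2$ and let $n \cdot S^1_{4n}$ denote the disjoint union of $n$ copies of the sunlet $S^1_{4n}$. Then there is a homomorphism $\varphi: n \cdot S^1_{4n} \to C_{2n} \,\Box\, C_{2n}$ which is a covering and is 2-to-1 on vertices, such that the restriction of $\varphi$ to the disjoint union of the $n$ cycles $Z(S^1_{4n})$ is an isomorphism onto the union of the $n$ staircases $T_0, \dots, T_{n-1}$, and $\varphi$ is compatible with the FSM orientation of $n \cdot S^1_{4n}$ and the standard orientation of $C_{2n} \,\Box\, C_{2n}$.
   Context: For $p \geq 3$, the sunlet $S^1_p$ is the graph obtained from a cycle $C_p$ by attaching one pendant edge at each vertex of the cycle ($2p$ vertices, $2p$ edges). $Z(S)$ denotes the unique cycle of a sunlet $S$. $C_{2n} \,\Box\, C_{2n}$ has vertex set $\mathbb{Z}_{2n} \times \mathbb{Z}_{2n}$, with $(a,b)$ adjacent to $(a\pm1,b)$ and $(a,b\pm1)$. The staircase $T_0$ is the $4n$-cycle $(0,0),(1,0),(1,1),(2,1),(2,2),(3,2),\ldots,(2n-1,2n-2),(2n-1,2n-1),(0,2n-1)$, closing back to $(0,0)$ (its vertices are $(i,i)$ and $(i+1,i)$ for $i \in \mathbb{Z}_{2n}$); for $k = 0,\dots,n-1$, the staircase $T_k$ is the image of $T_0$ under the translation $(a,b) \mapsto (a+2k,b)$ (so $T_k$ starts at $(2k,0)$). A homomorphism $\varphi: G \to H$ is a map $V(G)\to V(H)$ sending edges to edges; it is a covering if the induced map on edge sets is a bijection; it is 2-to-1 on vertices if every vertex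 of $H$ has exactly two preimages. The FSM orientation of a sunlet orients its cycle as a directed cycle and each pendant edge from its degree-1 vertex toward the cycle vertex; on a disjoint union of sunlets, each component is so oriented. The standard orientation of $C_{2n} \,\Box\, C_{2n}$ directs each edge toward increasing coordinate: $(a,b)\to(a+1,b)$ and $(a,b)\to(a,b+1)$ (indices mod $2n$). $\varphi$ is compatible with orientations if $(\varphi(u),\varphi(w))$ is an arc whenever $(u,w)$ is an arc. -}

module Defs where

open import Level using (0ℓ)
open import Data.Nat using (ℕ; zero; suc; _+_; _*_)
open import Data.Nat.DivMod using (_mod_)
open import Data.Fin using (Fin; toℕ)
open import Data.Product using (Σ; ∃; ∃-syntax; _×_; _,_)
open import Data.Sum using (_⊎_)
open import Relation.Binary.PropositionalEquality using (_≡_; _≢_)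
open import Relation.Nullary using (¬_)
open import Function.Bundles using (_⇔_)
open import Function.Definitions using (Bijective; Injective)

_⊕_ : ∀ {m} → Fin m → ℕ → Fin m
_⊕_ {suc m} a k = (toℕ a + k) mod (suc m)

-- The order of the ends (src → tgt) is the
-- orientation of the edge; as an undirected graph only the unordered
-- pair {src e , tgt e} matters.

record Graph : Set₁ where
  field
    V   : Set
    E   : Set
    src : E → V
    tgt : E → V
open Graph public

Link : ∀ {A : Set} → A → A → A → A → Set
Link x y a b = (x ≡ a × y ≡ b) ⊎ (x ≡ b × y ≡ a)

Adj : (G : Graph) → V G → V G → Set
Adj G u v = ∃[ e ] Link u v (src G e) (tgt G e)

Arc : (G : Graph) → V G → V G → Set
Arc G u w = ∃[ e ] (src G e ≡ u × tgt G e ≡ w)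

IsHom : (G H : Graph) → (V G → V H) → Set
IsHom G H φ = ∀ u v → Adj G u v → Adj H (φ u) (φ v)

-- covering: the induced map on edge sets, e ↦ {φ(src e), φ(tgt e)}, is a
-- bijection E G → E H.  (For a simple target H the edge with given ends
-- is unique, so ψ is exactly the induced map.)
IsCovering : (G H : Graph) → (V G → V H) → Set
IsCovering G H φ =
  Σ (E G → E H) λ ψ →
    (∀ e → Link (φ (src G e)) (φ (tgt G e)) (src H (ψ e)) (tgt H (ψ e)))
    × Bijective _≡_ _≡_ ψ

TwoToOne : ∀ {A B : Set} → (A → B) → Set
TwoToOne {A} φ = ∀ y → Σ A λ x₁ → Σ A λ x₂ →
  x₁ ≢ x₂ × φ x₁ ≡ y × φ x₂ ≡ y × (∀ x → φ x ≡ y → (x ≡ x₁ ⊎ x ≡ x₂))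

Compatible : (G H : Graph) → (V G → V H) → Set
Compatible G H φ = ∀ u w → Arc G u w → Arc H (φ u) (φ w)

-- n · S¹_p : disjoint union of n sunlets on p-cycles, with FSM orientation.
-- Vertex (k , i , cyc)  = i-th cycle vertex of copy k,
-- vertex (k , i , pend) = pendant vertex attached to it.

data SunV : Set where
  cyc pend : SunV

data SunE : Set where
  cycE pendE : SunE

sunSrc : ∀ {n p} → Fin n × Fin p × SunE → Fin n × Fin p × SunV
sunSrc (k , i , cycE)  = k , i , cyc
sunSrc (k , i , pendE) = k , i , pend

sunTgt : ∀ {n p} → Fin n × Fin p × SunE → Fin n × Fin p × SunV
sunTgt (k , i , cycE)  = k , i ⊕ 1 , cyc
sunTgt (k , i , pendE) = k , i , cyc

Sunlets : (n p : ℕ) → Graph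
Sunlets n p = record
  { V = Fin n × Fin p × SunV
  ; E = Fin n × Fin p × SunE
  ; src = sunSrc
  ; tgt = sunTgt
  }

Cycles : (n p : ℕ) → Graph
Cycles n p = record
  { V = Fin n × Fin p
  ; E = Fin n × Fin p
  ; src = λ z → z
  ; tgt = λ { (k , i) → k , i ⊕ 1 }
  }

ιZ : ∀ {n p} → Fin n × Fin p → Fin n × Fin p × SunV
ιZ (k , i) = k , i , cyc

data Dir : Set where
  horiz vert : Dir

torTgt : ∀ {m} → Fin m × Fin m × Dir → Fin m × Fin m
torTgt (a , b , horiz) = a ⊕ 1 , b
torTgt (a , b , vert)  = a , b ⊕ 1

Torus : (m : ℕ) → Graph
Torus m = record
  { V = Fin m × Fin m
  ; E = Fin m × Fin m × Dir
  ; src = λ { (a , b , _) → a , b }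
  ; tgt = torTgt
  }

-- Staircases in C_{2n} □ C_{2n}.
-- stV n k i r = the vertex (i + r + 2k , i) of T_k  (r ∈ {0,1}), so T_k
-- has vertices (i+2k , i), (i+1+2k , i), and is the cycle
--   … , stV k i 0 , stV k i 1 , stV k (i+1) 0 , stV k (i+1) 1 , …

stV : (n : ℕ) → Fin n → Fin (2 * n) → Fin 2 → Fin (2 * n) × Fin (2 * n)
stV n k i r = i ⊕ (toℕ r + 2 * toℕ k) , i

InStairs : (n : ℕ) → Fin (2 * n) × Fin (2 * n) → Set
InStairs n y = ∃[ k ] ∃[ i ] ∃[ r ] (stV n k i r ≡ y)

AdjStairs : (n : ℕ) → Fin (2 * n) × Fin (2 * n) → Fin (2 * n) × Fin (2 * n) → Set
AdjStairs n x y = ∃[ k ] ∃[ i ]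
  ( Link x y (stV n k i Fin.zero) (stV n k i (Fin.suc Fin.zero))
  ⊎ Link x y (stV n k i (Fin.suc Fin.zero)) (stV n k (i ⊕ 1) Fin.zero))

IsIsoOnto : (G : Graph) {W : Set} → (V G → W) → (W → Set) → (W → W → Set) → Set
IsIsoOnto G {W} f P A =
  Injective _≡_ _≡_ f
  × (∀ y → (∃[ z ] (f z ≡ y)) ⇔ P y)
  × (∀ z z' → Adj G z z' ⇔ A (f z) (f z'))

{-# OPTIONS --safe #-}
module Submission where

-- Label the vertex (j + r + 2k , j) of the staircase T_k by (k , j , r) ∈ ℤ_n × ℤ_2n × {0, 1};
-- these labels biject with the torus vertices, r + 2k being the residue of a − b at (a , b).
-- Sending the i-th cycle vertex of the k-th sunlet to (k , ⌊i/2⌋ , i mod 2) winds the cycles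
-- onto the staircases, each cycle edge going to the staircase edge leaving its source
-- (horizontal for r = 0, vertical for r = 1). The other out-edge of a torus vertex points in
-- the opposite direction, and every step of the torus flips r. So the pendant vertex at y can
-- be sent one step back from y along the staircase direction of y: its pendant edge becomes
-- the non-staircase out-edge there, which ends at y. Then every torus edge is used once, every
-- torus vertex twice (by a cycle and by a pendant vertex), and all orientations are kept.

open import Defs
open import Level using (0ℓ)
open import Data.Fin using (Fin; toℕ; cast; combine)
open import Data.Fin.Patterns using (0F; 1F)
open import Data.Fin.Properties
  using (toℕ-injective; toℕ-fromℕ<; toℕ<n; toℕ-cast; cast-involutive; toℕ-combine; *↔×)
open import Data.Nat using (ℕ; zero; suc; _+_; _*_; _∸_; _≤_; NonZero)
open import Data.Nat.DivMod
  using (_%_; %-distribˡ-+; %-congˡ; %-congʳ; [m+n]%n≡m%n; m%n%n≡m%n; m<n⇒m%n≡m; m%n*o≡m*o%[n*o])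
open import Data.Nat.Properties
  using (+-comm; +-assoc; +-commutativeSemigroup; *-comm; *-assoc; m+[n∸m]≡n; <⇒≤)
open import Data.Nat.Tactic.RingSolver using (solve-∀)
open import Algebra.Properties.CommutativeSemigroup +-commutativeSemigroup using (x∙yz≈y∙xz)
open import Data.Product using (Σ; ∃-syntax; _×_; _,_; proj₁; proj₂)
open import Data.Product.Algebra using (×-assoc)
open import Data.Product.Function.NonDependent.Propositional using (_×-↔_)
open import Data.Sum using (_⊎_; inj₁; inj₂)
open import Function using (_∘_)
open import Function.Bundles using (_↔_; _⇔_; mk⇔; mk↔ₛ′; Inverse; Bijection; Equivalence)
open import Function.Construct.Composition using (_↔-∘_)
open import Function.Construct.Identity using (↔-id)
open import Function.Construct.Symmetry using (↔-sym)
open import Function.Definitions using (Bijective; Injective)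
open import Function.Properties.Inverse using (↔⇒⤖)
open import Relation.Binary.PropositionalEquality
  using (_≡_; refl; sym; trans; cong; cong₂; subst₂; module ≡-Reasoning)

open Inverse using (to; from; strictlyInverseˡ; strictlyInverseʳ)

Link-map : ∀ {A B : Set} (f : A → B) {x y a b : A} →
           Link x y a b → Link (f x) (f y) (f a) (f b)
Link-map f (inj₁ (x≡a , y≡b)) = inj₁ (cong f x≡a , cong f y≡b)
Link-map f (inj₂ (x≡b , y≡a)) = inj₂ (cong f x≡b , cong f y≡a)

Link-injective : ∀ {A B : Set} {f : A → B} → Injective _≡_ _≡_ f → {x y a b : A} →
                 Link (f x) (f y) (f a) (f b) → Link x y a b
Link-injective inj (inj₁ (x≡a , y≡b)) = inj₁ (inj x≡a , inj y≡b)
Link-injective inj (inj₂ (x≡b , y≡a)) = inj₂ (inj x≡b , inj y≡a)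

record IsGraphMorphism (G H : Graph) (φ : V G → V H) (ψ : E G → E H) : Set where
  field
    src-commute : ∀ e → src H (ψ e) ≡ φ (src G e)
    tgt-commute : ∀ e → tgt H (ψ e) ≡ φ (tgt G e)

module _ {G H : Graph} {φ : V G → V H} {ψ : E G → E H} (morphism : IsGraphMorphism G H φ ψ) where

  open IsGraphMorphism morphism

  morphism⇒compatible : Compatible G H φ
  morphism⇒compatible u w (e , src≡u , tgt≡w) =
    ψ e , trans (src-commute e) (cong φ src≡u) , trans (tgt-commute e) (cong φ tgt≡w)

  morphism⇒hom : IsHom G H φ
  morphism⇒hom u v (e , link) =
    ψ e , subst₂ (Link (φ u) (φ v)) (sym (src-commute e)) (sym (tgt-commute e)) (Link-map φ link)

  morphism⇒covering : Bijective _≡_ _≡_ ψ → IsCovering G H φ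
  morphism⇒covering bij = ψ , (λ e → inj₁ (sym (src-commute e) , sym (tgt-commute e))) , bij

module _ {n p : ℕ} {B : Set} where

  sunletMap : (Fin n × Fin p → B) → (Fin n × Fin p → B) → V (Sunlets n p) → B
  sunletMap f g (k , i , cyc)  = f (k , i)
  sunletMap f g (k , i , pend) = g (k , i)

  sunletMap-twoToOne : (f g : (Fin n × Fin p) ↔ B) → TwoToOne (sunletMap (to f) (to g))
  sunletMap-twoToOne f g y =
    vertex (from f y) cyc , vertex (from g y) pend , (λ ()) ,
    strictlyInverseˡ f y , strictlyInverseˡ g y , unique
    where
      vertex : Fin n × Fin p → SunV → V (Sunlets n p)
      vertex (k , i) t = k , i , t

      unique : ∀ x → sunletMap (to f) (to g) x ≡ y →
               x ≡ vertex (from f y) cyc ⊎ x ≡ vertex (from g y) pend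
      unique (k , i , cyc)  fz≡y = inj₁ (cong (λ z → vertex z cyc)
        (trans (sym (strictlyInverseʳ f (k , i))) (cong (from f) fz≡y)))
      unique (k , i , pend) gz≡y = inj₂ (cong (λ z → vertex z pend)
        (trans (sym (strictlyInverseʳ g (k , i))) (cong (from g) gz≡y)))

[m%d+n]%d≡[m+n]%d : ∀ m n d .{{_ : NonZero d}} → (m % d + n) % d ≡ (m + n) % d
[m%d+n]%d≡[m+n]%d m n d = begin
  (m % d + n) % d          ≡⟨ %-distribˡ-+ (m % d) n d ⟩
  (m % d % d + n % d) % d  ≡⟨ %-congˡ (cong (_+ n % d) (m%n%n≡m%n m d)) ⟩
  (m % d + n % d) % d      ≡⟨ %-distribˡ-+ m n d ⟨
  (m + n) % d              ∎
  where open ≡-Reasoning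

[m+n%d]%d≡[m+n]%d : ∀ m n d .{{_ : NonZero d}} → (m + n % d) % d ≡ (m + n) % d
[m+n%d]%d≡[m+n]%d m n d = begin
  (m + n % d) % d  ≡⟨ %-congˡ (+-comm m (n % d)) ⟩
  (n % d + m) % d  ≡⟨ [m%d+n]%d≡[m+n]%d n m d ⟩
  (n + m) % d      ≡⟨ %-congˡ (+-comm n m) ⟩
  (m + n) % d      ∎
  where open ≡-Reasoning

2*[m%n]≡2*m%[2*n] : ∀ m n → 2 * (m % suc n) ≡ 2 * m % (2 * suc n)
2*[m%n]≡2*m%[2*n] m n = begin
  2 * (m % suc n)          ≡⟨ *-comm 2 (m % suc n) ⟩
  m % suc n * 2            ≡⟨ m%n*o≡m*o%[n*o] m (suc n) 2 ⟩
  m * 2 % (suc n * 2)      ≡⟨ %-congˡ (*-comm m 2) ⟩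
  2 * m % (suc n * 2)      ≡⟨ %-congʳ {o = 2 * m} (*-comm (suc n) 2) ⟩
  2 * m % (2 * suc n)      ∎
  where open ≡-Reasoning

module _ {m : ℕ} where

  toℕ-⊕ : (a : Fin (suc m)) (x : ℕ) → toℕ (a ⊕ x) ≡ (toℕ a + x) % suc m
  toℕ-⊕ a x = toℕ-fromℕ< _

  ⊕-cong : (a : Fin (suc m)) {x y : ℕ} → x % suc m ≡ y % suc m → a ⊕ x ≡ a ⊕ y
  ⊕-cong a {x} {y} x≡y = toℕ-injective (begin
    toℕ (a ⊕ x)                  ≡⟨ toℕ-⊕ a x ⟩
    (toℕ a + x) % suc m          ≡⟨ [m+n%d]%d≡[m+n]%d (toℕ a) x (suc m) ⟨
    (toℕ a + x % suc m) % suc m  ≡⟨ %-congˡ (cong (toℕ a +_) x≡y) ⟩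
    (toℕ a + y % suc m) % suc m  ≡⟨ [m+n%d]%d≡[m+n]%d (toℕ a) y (suc m) ⟩
    (toℕ a + y) % suc m          ≡⟨ toℕ-⊕ a y ⟨
    toℕ (a ⊕ y)                  ∎)
    where open ≡-Reasoning

  ⊕-assoc : (a : Fin (suc m)) (x y : ℕ) → (a ⊕ x) ⊕ y ≡ a ⊕ (x + y)
  ⊕-assoc a x y = toℕ-injective (begin
    toℕ ((a ⊕ x) ⊕ y)                  ≡⟨ toℕ-⊕ (a ⊕ x) y ⟩
    (toℕ (a ⊕ x) + y) % suc m          ≡⟨ %-congˡ (cong (_+ y) (toℕ-⊕ a x)) ⟩
    ((toℕ a + x) % suc m + y) % suc m  ≡⟨ [m%d+n]%d≡[m+n]%d (toℕ a + x) y (suc m) ⟩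
    (toℕ a + x + y) % suc m            ≡⟨ %-congˡ (+-assoc (toℕ a) x y) ⟩
    (toℕ a + (x + y)) % suc m          ≡⟨ toℕ-⊕ a (x + y) ⟨
    toℕ (a ⊕ (x + y))                  ∎)
    where open ≡-Reasoning

  ⊕-period : (a : Fin (suc m)) → a ⊕ suc m ≡ a
  ⊕-period a = toℕ-injective (begin
    toℕ (a ⊕ suc m)              ≡⟨ toℕ-⊕ a (suc m) ⟩
    (toℕ a + suc m) % suc m      ≡⟨ [m+n]%n≡m%n (toℕ a) (suc m) ⟩
    toℕ a % suc m                ≡⟨ m<n⇒m%n≡m (toℕ<n a) ⟩
    toℕ a                        ∎)
    where open ≡-Reasoning

  ⊕-pred-⊕-suc : (a : Fin (suc m)) → (a ⊕ m) ⊕ 1 ≡ a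
  ⊕-pred-⊕-suc a = trans (⊕-assoc a m 1) (trans (cong (a ⊕_) (+-comm m 1)) (⊕-period a))

  ⊕-suc-⊕-pred : (a : Fin (suc m)) → (a ⊕ 1) ⊕ m ≡ a
  ⊕-suc-⊕-pred a = trans (⊕-assoc a 1 m) (⊕-period a)

  infixl 6 _⊖_
  _⊖_ : Fin (suc m) → Fin (suc m) → Fin (suc m)
  a ⊖ b = a ⊕ (suc m ∸ toℕ b)

  ⊕-toℕ-⊕ : (a b : Fin (suc m)) (x : ℕ) → b ⊕ toℕ (a ⊕ x) ≡ b ⊕ (toℕ a + x)
  ⊕-toℕ-⊕ a b x = ⊕-cong b (trans (%-congˡ (toℕ-⊕ a x)) (m%n%n≡m%n (toℕ a + x) (suc m)))

  ⊕-toℕ-⊖-cancel : (b c : Fin (suc m)) → (b ⊕ toℕ c) ⊖ b ≡ c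
  ⊕-toℕ-⊖-cancel b c = toℕ-injective (begin
    toℕ ((b ⊕ toℕ c) ⊖ b)                        ≡⟨ cong toℕ (⊕-assoc b (toℕ c) _) ⟩
    toℕ (b ⊕ (toℕ c + (suc m ∸ toℕ b)))          ≡⟨ toℕ-⊕ b _ ⟩
    (toℕ b + (toℕ c + (suc m ∸ toℕ b))) % suc m  ≡⟨ %-congˡ (x∙yz≈y∙xz (toℕ b) (toℕ c) _) ⟩
    (toℕ c + (toℕ b + (suc m ∸ toℕ b))) % suc m  ≡⟨ %-congˡ (cong (toℕ c +_) (m+[n∸m]≡n (<⇒≤ (toℕ<n b)))) ⟩
    (toℕ c + suc m) % suc m                      ≡⟨ [m+n]%n≡m%n (toℕ c) (suc m) ⟩
    toℕ c % suc m                                ≡⟨ m<n⇒m%n≡m (toℕ<n c) ⟩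
    toℕ c                                        ∎)
    where open ≡-Reasoning

  ⊕-toℕ-⊖ : (a b : Fin (suc m)) → b ⊕ toℕ (a ⊖ b) ≡ a
  ⊕-toℕ-⊖ a b = begin
    b ⊕ toℕ (a ⊖ b)                ≡⟨ ⊕-toℕ-⊕ a b _ ⟩
    b ⊕ (toℕ a + (suc m ∸ toℕ b))  ≡⟨ ⊕-assoc b (toℕ a) _ ⟨
    (b ⊕ toℕ a) ⊖ b                ≡⟨ ⊕-toℕ-⊖-cancel b a ⟩
    a                              ∎
    where open ≡-Reasoning

cast↔ : ∀ {m n} → m ≡ n → Fin m ↔ Fin n
cast↔ eq = mk↔ₛ′ (cast eq) (cast (sym eq))
  (cast-involutive eq (sym eq)) (cast-involutive (sym eq) eq)

nextHalf : ∀ {m} → Fin (suc m) × Fin 2 → Fin (suc m) × Fin 2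
nextHalf (j , 0F) = j , 1F
nextHalf (j , 1F) = j ⊕ 1 , 0F

module Halving {N m : ℕ} (eq : suc N ≡ 2 * suc m) where

  halves : Fin (suc N) ↔ (Fin (suc m) × Fin 2)
  halves = *↔× ↔-∘ cast↔ (trans eq (*-comm 2 (suc m)))

  toℕ-halves⁻¹ : ∀ j r → toℕ (from halves (j , r)) ≡ toℕ r + 2 * toℕ j
  toℕ-halves⁻¹ j r =
    trans (toℕ-cast _ (combine j r)) (trans (toℕ-combine j r) (+-comm _ (toℕ r)))

  from-halves-⊕1 : ∀ h → from halves h ⊕ 1 ≡ from halves (nextHalf h)
  from-halves-⊕1 (j , 0F) = toℕ-injective (begin
    toℕ (from halves (j , 0F) ⊕ 1)          ≡⟨ toℕ-⊕ (from halves (j , 0F)) 1 ⟩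
    (toℕ (from halves (j , 0F)) + 1) % suc N ≡⟨ %-congˡ (cong (_+ 1) (toℕ-halves⁻¹ j 0F)) ⟩
    (2 * toℕ j + 1) % suc N                 ≡⟨ %-congˡ (+-comm (2 * toℕ j) 1) ⟩
    (1 + 2 * toℕ j) % suc N                 ≡⟨ %-congˡ (toℕ-halves⁻¹ j 1F) ⟨
    toℕ (from halves (j , 1F)) % suc N      ≡⟨ m<n⇒m%n≡m (toℕ<n (from halves (j , 1F))) ⟩
    toℕ (from halves (j , 1F))              ∎)
    where open ≡-Reasoning
  from-halves-⊕1 (j , 1F) = toℕ-injective (begin
    toℕ (from halves (j , 1F) ⊕ 1)          ≡⟨ toℕ-⊕ (from halves (j , 1F)) 1 ⟩
    (toℕ (from halves (j , 1F)) + 1) % suc N ≡⟨ %-congˡ (cong (_+ 1) (toℕ-halves⁻¹ j 1F)) ⟩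
    (1 + 2 * toℕ j + 1) % suc N             ≡⟨ %-congˡ (arith (toℕ j)) ⟩
    2 * (toℕ j + 1) % suc N                 ≡⟨ %-congʳ {o = 2 * (toℕ j + 1)} eq ⟩
    2 * (toℕ j + 1) % (2 * suc m)           ≡⟨ 2*[m%n]≡2*m%[2*n] (toℕ j + 1) m ⟨
    2 * ((toℕ j + 1) % suc m)               ≡⟨ cong (2 *_) (toℕ-⊕ j 1) ⟨
    2 * toℕ (j ⊕ 1)                         ≡⟨ toℕ-halves⁻¹ (j ⊕ 1) 0F ⟨
    toℕ (from halves (j ⊕ 1 , 0F))          ∎)
    where
      open ≡-Reasoning
      arith : ∀ x → 1 + 2 * x + 1 ≡ 2 * (x + 1)
      arith = solve-∀

  halves-⊕1 : ∀ i → to halves (i ⊕ 1) ≡ nextHalf (to halves i)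
  halves-⊕1 i = begin
    to halves (i ⊕ 1)
      ≡⟨ cong (λ i′ → to halves (i′ ⊕ 1)) (strictlyInverseʳ halves i) ⟨
    to halves (from halves (to halves i) ⊕ 1)
      ≡⟨ cong (to halves) (from-halves-⊕1 (to halves i)) ⟩
    to halves (from halves (nextHalf (to halves i)))
      ≡⟨ strictlyInverseˡ halves _ ⟩
    nextHalf (to halves i)
      ∎
    where open ≡-Reasoning

⊕-+-double : ∀ {n} (a : Fin (2 * suc n)) c (k : Fin (suc n)) x →
             a ⊕ (c + 2 * toℕ (k ⊕ x)) ≡ a ⊕ (c + 2 * (toℕ k + x))
⊕-+-double {n} a c k x = ⊕-cong a (begin
  (c + 2 * toℕ (k ⊕ x)) % (2 * suc n)              ≡⟨ %-congˡ (cong (λ t → c + 2 * t) (toℕ-⊕ k x)) ⟩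
  (c + 2 * ((toℕ k + x) % suc n)) % (2 * suc n)    ≡⟨ %-congˡ (cong (c +_) (2*[m%n]≡2*m%[2*n] (toℕ k + x) n)) ⟩
  (c + 2 * (toℕ k + x) % (2 * suc n)) % (2 * suc n) ≡⟨ [m+n%d]%d≡[m+n]%d c (2 * (toℕ k + x)) (2 * suc n) ⟩
  (c + 2 * (toℕ k + x)) % (2 * suc n)              ∎)
  where open ≡-Reasoning

module Staircases (n₀ : ℕ) where

  n M : ℕ
  n = suc n₀
  M = 2 * n

  Y T : Set
  Y = Fin n × Fin M × Fin 2
  T = Fin M × Fin M

  θ : Y → T
  θ (k , j , r) = stV n k j r

  open Halving {N = M ∸ 1} {m = n₀} refl
    using () renaming (halves to offset; toℕ-halves⁻¹ to toℕ-offset⁻¹)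
  open Halving {N = 4 * n ∸ 1} {m = M ∸ 1} (*-assoc 2 2 n)
    using () renaming (halves to cycleIndex; halves-⊕1 to cycleIndex-⊕1)

  θ⁻¹ : T → Y
  θ⁻¹ (a , b) = let (k , r) = to offset (a ⊖ b) in k , b , r

  θ-θ⁻¹ : ∀ t → θ (θ⁻¹ t) ≡ t
  θ-θ⁻¹ (a , b) = cong (_, b) (begin
    b ⊕ (toℕ r + 2 * toℕ k)        ≡⟨ cong (b ⊕_) (toℕ-offset⁻¹ k r) ⟨
    b ⊕ toℕ (from offset (k , r))  ≡⟨ cong (λ c → b ⊕ toℕ c) (strictlyInverseʳ offset (a ⊖ b)) ⟩
    b ⊕ toℕ (a ⊖ b)                ≡⟨ ⊕-toℕ-⊖ a b ⟩
    a                              ∎)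
    where
      open ≡-Reasoning
      k = proj₁ (to offset (a ⊖ b))
      r = proj₂ (to offset (a ⊖ b))

  θ⁻¹-θ : ∀ y → θ⁻¹ (θ y) ≡ y
  θ⁻¹-θ (k , j , r) = cong (λ (k′ , r′) → k′ , j , r′) (begin
    to offset ((j ⊕ (toℕ r + 2 * toℕ k)) ⊖ j)        ≡⟨ cong (λ c → to offset ((j ⊕ c) ⊖ j)) (toℕ-offset⁻¹ k r) ⟨
    to offset ((j ⊕ toℕ (from offset (k , r))) ⊖ j)  ≡⟨ cong (to offset) (⊕-toℕ-⊖-cancel j _) ⟩
    to offset (from offset (k , r))                  ≡⟨ strictlyInverseˡ offset (k , r) ⟩
    (k , r)                                          ∎)
    where open ≡-Reasoning

  θ↔ : Y ↔ T
  θ↔ = mk↔ₛ′ θ θ⁻¹ θ-θ⁻¹ θ⁻¹-θ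

  edge : T → Dir → E (Torus M)
  edge (a , b) d = a , b , d

  step : Dir → Y → Y
  step horiz (k , j , 0F) = k , j , 1F
  step horiz (k , j , 1F) = k ⊕ 1 , j , 0F
  step vert  (k , j , 0F) = k ⊕ (n ∸ 1) , j ⊕ 1 , 1F
  step vert  (k , j , 1F) = k , j ⊕ 1 , 0F

  θ-step : ∀ d y → θ (step d y) ≡ tgt (Torus M) (edge (θ y) d)
  θ-step horiz (k , j , 0F) = cong (_, j) (begin
    j ⊕ (1 + 2 * toℕ k)    ≡⟨ cong (j ⊕_) (+-comm 1 (2 * toℕ k)) ⟩
    j ⊕ (2 * toℕ k + 1)    ≡⟨ ⊕-assoc j (2 * toℕ k) 1 ⟨
    (j ⊕ (2 * toℕ k)) ⊕ 1  ∎)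
    where open ≡-Reasoning
  θ-step horiz (k , j , 1F) = cong (_, j) (begin
    j ⊕ (2 * toℕ (k ⊕ 1))      ≡⟨ ⊕-+-double j 0 k 1 ⟩
    j ⊕ (2 * (toℕ k + 1))      ≡⟨ cong (j ⊕_) (arith (toℕ k)) ⟩
    j ⊕ (1 + 2 * toℕ k + 1)    ≡⟨ ⊕-assoc j (1 + 2 * toℕ k) 1 ⟨
    (j ⊕ (1 + 2 * toℕ k)) ⊕ 1  ∎)
    where
      open ≡-Reasoning
      arith : ∀ x → 2 * (x + 1) ≡ 1 + 2 * x + 1
      arith = solve-∀
  θ-step vert (k , j , 0F) = cong (_, j ⊕ 1) (begin
    (j ⊕ 1) ⊕ (1 + 2 * toℕ (k ⊕ n₀))  ≡⟨ ⊕-assoc j 1 (1 + 2 * toℕ (k ⊕ n₀)) ⟩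
    j ⊕ (2 + 2 * toℕ (k ⊕ n₀))        ≡⟨ ⊕-+-double j 2 k n₀ ⟩
    j ⊕ (2 + 2 * (toℕ k + n₀))        ≡⟨ cong (j ⊕_) (arith (toℕ k) n₀) ⟩
    j ⊕ (2 * toℕ k + M)               ≡⟨ ⊕-assoc j (2 * toℕ k) M ⟨
    (j ⊕ (2 * toℕ k)) ⊕ M             ≡⟨ ⊕-period (j ⊕ (2 * toℕ k)) ⟩
    j ⊕ (2 * toℕ k)                   ∎)
    where
      open ≡-Reasoning
      arith : ∀ x y → 2 + 2 * (x + y) ≡ 2 * x + 2 * suc y
      arith = solve-∀
  θ-step vert (k , j , 1F) = cong (_, j ⊕ 1) (⊕-assoc j 1 (2 * toℕ k))

  stairDir : Y → Dir
  stairDir (_ , _ , 0F) = horiz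
  stairDir (_ , _ , 1F) = vert

  next : Y → Y
  next y = step (stairDir y) y

  opposite : Dir → Dir
  opposite horiz = vert
  opposite vert  = horiz

  pendant : Y → Y
  pendant (k , j , 0F) = k ⊕ (n ∸ 1) , j , 1F
  pendant (k , j , 1F) = k ⊕ 1 , j ⊕ (M ∸ 1) , 0F

  step-stairDir-pendant : ∀ y → step (stairDir y) (pendant y) ≡ y
  step-stairDir-pendant (k , j , 0F) = cong (λ k′ → k′ , j , 0F) (⊕-pred-⊕-suc k)
  step-stairDir-pendant (k , j , 1F) = cong₂ (λ k′ j′ → k′ , j′ , 1F) (⊕-suc-⊕-pred k) (⊕-pred-⊕-suc j)

  pendant-step-opposite : ∀ y → pendant (step (opposite (stairDir y)) y) ≡ y
  pendant-step-opposite (k , j , 0F) = cong₂ (λ k′ j′ → k′ , j′ , 0F) (⊕-pred-⊕-suc k) (⊕-suc-⊕-pred j)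
  pendant-step-opposite (k , j , 1F) = cong (λ k′ → k′ , j , 1F) (⊕-suc-⊕-pred k)

  pendant↔ : Y ↔ Y
  pendant↔ = mk↔ₛ′ pendant (λ y → step (opposite (stairDir y)) y) pendant-step-opposite λ where
    y@(_ , _ , 0F) → step-stairDir-pendant y
    y@(_ , _ , 1F) → step-stairDir-pendant y

  edgeImage : Y × SunE → Y × Dir
  edgeImage (y , cycE)  = y , stairDir y
  edgeImage (y , pendE) = pendant y , stairDir y

  edgeImage⁻¹ : Y × Dir → Y × SunE
  edgeImage⁻¹ (y@(_ , _ , 0F) , horiz) = y , cycE
  edgeImage⁻¹ (y@(_ , _ , 1F) , vert)  = y , cycE
  edgeImage⁻¹ (y@(_ , _ , 0F) , vert)  = step vert y , pendE
  edgeImage⁻¹ (y@(_ , _ , 1F) , horiz) = step horiz y , pendE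

  edgeImage-edgeImage⁻¹ : ∀ e → edgeImage (edgeImage⁻¹ e) ≡ e
  edgeImage-edgeImage⁻¹ (y@(_ , _ , 0F) , horiz) = refl
  edgeImage-edgeImage⁻¹ (y@(_ , _ , 1F) , vert)  = refl
  edgeImage-edgeImage⁻¹ (y@(_ , _ , 0F) , vert)  = cong (_, vert) (pendant-step-opposite y)
  edgeImage-edgeImage⁻¹ (y@(_ , _ , 1F) , horiz) = cong (_, horiz) (pendant-step-opposite y)

  edgeImage⁻¹-edgeImage : ∀ e → edgeImage⁻¹ (edgeImage e) ≡ e
  edgeImage⁻¹-edgeImage (y@(_ , _ , 0F) , cycE)  = refl
  edgeImage⁻¹-edgeImage (y@(_ , _ , 1F) , cycE)  = refl
  edgeImage⁻¹-edgeImage (y@(_ , _ , 0F) , pendE) = cong (_, pendE) (step-stairDir-pendant y)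
  edgeImage⁻¹-edgeImage (y@(_ , _ , 1F) , pendE) = cong (_, pendE) (step-stairDir-pendant y)

  edgeImage↔ : (Y × SunE) ↔ (Y × Dir)
  edgeImage↔ = mk↔ₛ′ edgeImage edgeImage⁻¹ edgeImage-edgeImage⁻¹ edgeImage⁻¹-edgeImage

  X : Set
  X = Fin n × Fin (4 * n)

  ζ↔ : X ↔ Y
  ζ↔ = ↔-id (Fin n) ×-↔ cycleIndex

  ζ-⊕1 : ∀ k i → to ζ↔ (k , i ⊕ 1) ≡ next (to ζ↔ (k , i))
  ζ-⊕1 k i with to cycleIndex i | cycleIndex-⊕1 i
  ... | j , 0F | eq = cong (k ,_) eq
  ... | j , 1F | eq = cong (k ,_) eq

  pos↔ pendantPos↔ : X ↔ T
  pos↔ = θ↔ ↔-∘ ζ↔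
  pendantPos↔ = θ↔ ↔-∘ (pendant↔ ↔-∘ ζ↔)

  pos : X → T
  pos = to pos↔

  pos-⊕1 : ∀ e → pos (tgt (Cycles n (4 * n)) e) ≡ θ (next (to ζ↔ e))
  pos-⊕1 (k , i) = cong θ (ζ-⊕1 k i)

  φ : V (Sunlets n (4 * n)) → V (Torus M)
  φ = sunletMap pos (to pendantPos↔)

  ψ↔ : E (Sunlets n (4 * n)) ↔ E (Torus M)
  ψ↔ = ×-assoc 0ℓ (Fin M) (Fin M) Dir ↔-∘ ((θ↔ ×-↔ ↔-id Dir) ↔-∘ (edgeImage↔
        ↔-∘ ((ζ↔ ×-↔ ↔-id SunE) ↔-∘ ↔-sym (×-assoc 0ℓ (Fin n) (Fin (4 * n)) SunE))))

  ψ-tgt-commute : ∀ e → tgt (Torus M) (to ψ↔ e) ≡ φ (tgt (Sunlets n (4 * n)) e)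
  ψ-tgt-commute (k , i , cycE)  = trans (sym (θ-step (stairDir y) y)) (sym (pos-⊕1 (k , i)))
    where y = to ζ↔ (k , i)
  ψ-tgt-commute (k , i , pendE) =
    trans (sym (θ-step (stairDir y) (pendant y))) (cong θ (step-stairDir-pendant y))
    where y = to ζ↔ (k , i)

  ψ-morphism : IsGraphMorphism (Sunlets n (4 * n)) (Torus M) φ (to ψ↔)
  ψ-morphism = record
    { src-commute = λ where (_ , _ , cycE) → refl ; (_ , _ , pendE) → refl
    ; tgt-commute = ψ-tgt-commute
    }

  adjStairs⇔ : ∀ {x x′} → AdjStairs n x x′ ⇔ (∃[ y ] Link x x′ (θ y) (θ (next y)))
  adjStairs⇔ = mk⇔
    (λ { (k , j , inj₁ l) → (k , j , 0F) , l ; (k , j , inj₂ l) → (k , j , 1F) , l })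
    (λ { ((k , j , 0F) , l) → k , j , inj₁ l ; ((k , j , 1F) , l) → k , j , inj₂ l })

  pos-injective : Injective _≡_ _≡_ pos
  pos-injective = Bijection.injective (↔⇒⤖ pos↔)

  pos-image : ∀ t → (∃[ z ] pos z ≡ t) ⇔ InStairs n t
  pos-image t = mk⇔
    (λ (z , pz≡t) → let (k , j , r) = to ζ↔ z in k , j , r , pz≡t)
    (λ (k , j , r , θy≡t) →
      from ζ↔ (k , j , r) , trans (cong θ (strictlyInverseˡ ζ↔ (k , j , r))) θy≡t)

  pos-adjacency : ∀ z z′ → Adj (Cycles n (4 * n)) z z′ ⇔ AdjStairs n (pos z) (pos z′)
  pos-adjacency z z′ = mk⇔
    (λ (e , l) → Equivalence.from adjStairs⇔
      (to ζ↔ e , subst₂ (Link (pos z) (pos z′)) refl (pos-⊕1 e) (Link-map pos l)))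
    (λ s → let (y , l) = Equivalence.to adjStairs⇔ s in from ζ↔ y , Link-injective pos-injective
      (subst₂ (Link (pos z) (pos z′)) (sym (pos-from y)) (sym (pos-⊕1-from y)) l))
    where
      pos-from : ∀ y → pos (from ζ↔ y) ≡ θ y
      pos-from y = cong θ (strictlyInverseˡ ζ↔ y)
      pos-⊕1-from : ∀ y → pos (tgt (Cycles n (4 * n)) (from ζ↔ y)) ≡ θ (next y)
      pos-⊕1-from y = trans (pos-⊕1 (from ζ↔ y)) (cong (θ ∘ next) (strictlyInverseˡ ζ↔ y))

  pos-isoOnto : IsIsoOnto (Cycles n (4 * n)) pos (InStairs n) (AdjStairs n)
  pos-isoOnto = pos-injective , pos-image , pos-adjacency

theorem2 : ∀ (n : ℕ) → 2 ≤ n →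
    Σ (V (Sunlets n (4 * n)) → V (Torus (2 * n))) λ φ →
      IsHom (Sunlets n (4 * n)) (Torus (2 * n)) φ
      × IsCovering (Sunlets n (4 * n)) (Torus (2 * n)) φ
      × TwoToOne φ
      × IsIsoOnto (Cycles n (4 * n)) (φ ∘ ιZ) (InStairs n) (AdjStairs n)
      × Compatible (Sunlets n (4 * n)) (Torus (2 * n)) φ
theorem2 zero ()
theorem2 (suc n₀) _ =
  φ ,
  morphism⇒hom ψ-morphism ,
  morphism⇒covering ψ-morphism (Bijection.bijective (↔⇒⤖ ψ↔)) ,
  sunletMap-twoToOne pos↔ pendantPos↔ ,
  pos-isoOnto ,
  morphism⇒compatible ψ-morphism
  where open Staircases n₀
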